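{- Let $X$ be a finite set with $|X|\ge 3$ and $T$ a binary phylogenetic $X$-tree. (M1) If $\mathcal T$ is a minimal triplet cover for $T$, then $2\le\mu(\mathcal T)\le 5$. (M2) If $\mathcal T$ is a minimum triplet cover for $T$, then $2\le\mu(\mathcal T)\le 3$.
   Context: A binary phylogenetic $X$-tree is an unrooted tree whose leaf set is $X$ and in which every non-leaf (interior) vertex has degree $3$. For $\mathcal T\subseteq\binom{X}{2}$ and an interior vertex $v$, a triple $\{a,b,c\}\subseteq X$ supports $v$ if $a,b,c$ lie one in each of the three components of $T$ minus $v$ and $\{a,b\},\{a,c\},\{b,c\}\in\mathcal T$. $\mathcal T$ is a triplet cover for $T$ if every interior vertex is supported by some triple. A triplet cover is minimal if removing any single pair from it yields a set that is not a triplet cover for $T$; it is minimum if no triplet cover for $T$ has smaller cardinality. For $x\in X$, $\mu_{\mathcal T}(x)$ is the number of elements of $\mathcal T$ containing $x$, and $\mu(\mathcal T)=\min_{x\in X}\mu_{\mathcal T}(x)$. -}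

module Defs where

open import Data.Nat using (ℕ; zero; suc; _+_; _≤_; _<ᵇ_)
open import Data.Fin using (Fin; toℕ; _≟_)
open import Data.Nat.ListAction using (sum)
open import Data.List using (List; []; _∷_; length; _++_; take; map; allFin)
open import Data.List.Relation.Unary.AllPairs using (AllPairs)
open import Data.List.Relation.Unary.Linked using (Linked)
open import Data.Bool using (Bool; true; false; _∧_; _∨_; not; if_then_else_)
open import Data.Sum using (_⊎_; inj₁; inj₂)
open import Data.Product using (_×_; ∃; ∃-syntax; Σ-syntax)
open import Data.Unit using (⊤)
open import Relation.Nullary using (¬_; ⌊_⌋)
open import Relation.Binary.PropositionalEquality using (_≡_; _≢_)

-- Vertices of an X-tree with X = Fin m (leaves) and k interior vertices.

Vtx : ℕ → ℕ → Set
Vtx m k = Fin m ⊎ Fin k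

Adj : ℕ → ℕ → Set
Adj m k = Vtx m k → Vtx m k → Bool

data Walk {m k : ℕ} (E : Adj m k) (ok : Vtx m k → Set) : Vtx m k → Vtx m k → Set where
  here : ∀ {u} → ok u → Walk E ok u u
  step : ∀ {u w v} → ok u → E u w ≡ true → Walk E ok w v → Walk E ok u v

IsCycle : ∀ {m k} → Adj m k → List (Vtx m k) → Set
IsCycle E cs = (3 ≤ length cs) × AllPairs _≢_ cs
             × Linked (λ a b → E a b ≡ true) (cs ++ take 1 cs)

Degree1 : ∀ {m k} → Adj m k → Vtx m k → Set
Degree1 E v = ∃[ a ] (∀ u → E v u ≡ true → u ≡ a) × E v a ≡ true

Degree3 : ∀ {m k} → Adj m k → Vtx m k → Set
Degree3 E v = ∃[ a ] ∃[ b ] ∃[ c ]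
  (a ≢ b × a ≢ c × b ≢ c)
  × (E v a ≡ true × E v b ≡ true × E v c ≡ true)
  × (∀ u → E v u ≡ true → (u ≡ a ⊎ u ≡ b ⊎ u ≡ c))

record BinaryPhyloTree (m k : ℕ) : Set where
  field
    adj        : Adj m k
    adj-sym    : ∀ u v → adj u v ≡ adj v u
    adj-irrefl : ∀ v → adj v v ≡ false
    connected  : ∀ u v → Walk adj (λ _ → ⊤) u v
    acyclic    : ∀ cs → ¬ IsCycle adj cs
    leaf-deg   : ∀ (x : Fin m) → Degree1 adj (inj₁ x)
    int-deg    : ∀ (i : Fin k) → Degree3 adj (inj₂ i)
open BinaryPhyloTree public

-- Sets of 2-subsets of X = Fin m, as symmetric irreflexive Bool relations.

PairRel : ℕ → Set
PairRel m = Fin m → Fin m → Bool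

IsPairSet : ∀ {m} → PairRel m → Set
IsPairSet P = (∀ x y → P x y ≡ P y x) × (∀ x → P x x ≡ false)

count : ∀ {A : Set} → (A → Bool) → List A → ℕ
count p []       = 0
count p (a ∷ as) = (if p a then 1 else 0) + count p as

size : ∀ {m} → PairRel m → ℕ
size {m} P = sum (map (λ i → count (λ j → (toℕ i <ᵇ toℕ j) ∧ P i j) (allFin m)) (allFin m))

mult : ∀ {m} → PairRel m → Fin m → ℕ
mult {m} P x = count (P x) (allFin m)

removePair : ∀ {m} → PairRel m → Fin m → Fin m → PairRel m
removePair P a b x y =
  P x y ∧ not ((⌊ x ≟ a ⌋ ∧ ⌊ y ≟ b ⌋) ∨ (⌊ x ≟ b ⌋ ∧ ⌊ y ≟ a ⌋))

Supports : ∀ {m k} → BinaryPhyloTree m k → PairRel m → Fin k → Fin m → Fin m → Fin m → Set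
Supports {m} T P i a b c =
  let v   = inj₂ i
      sep : Fin m → Fin m → Set
      sep x y = ¬ Walk (adj T) (λ u → u ≢ v) (inj₁ x) (inj₁ y)
  in (sep a b × sep a c × sep b c)
     × (P a b ≡ true × P a c ≡ true × P b c ≡ true)

IsTripletCover : ∀ {m k} → BinaryPhyloTree m k → PairRel m → Set
IsTripletCover {m} {k} T P = ∀ (i : Fin k) → ∃[ a ] ∃[ b ] ∃[ c ] Supports T P i a b c

IsMinimalTripletCover : ∀ {m k} → BinaryPhyloTree m k → PairRel m → Set
IsMinimalTripletCover T P =
  IsPairSet P × IsTripletCover T P
  × (∀ a b → P a b ≡ true → ¬ IsTripletCover T (removePair P a b))

IsMinimumTripletCover : ∀ {m k} → BinaryPhyloTree m k → PairRel m → Set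
IsMinimumTripletCover T P =
  IsPairSet P × IsTripletCover T P
  × (∀ Q → IsPairSet Q → IsTripletCover T Q → size P ≤ size Q)

-- lo ≤ μ(𝒯) ≤ hi, with μ(𝒯) = min over x of μ_𝒯(x) (X nonempty).
MuBetween : ∀ {m} → ℕ → ℕ → PairRel m → Set
MuBetween lo hi P = (∀ x → lo ≤ mult P x) × (∃[ x ] mult P x ≤ hi)

-- The neighbour v of a leaf x is interior.  A triple supporting v that avoids x
-- would place three leaves in the two components of T − v not containing x, so two of them
-- would be joined avoiding v; hence x belongs to the triple and lies in two of its pairs.
--
-- Rooting T at a leaf, every interior vertex has two children, so k < m.  In a
-- minimal cover every pair belongs to the chosen supporting triple of some interior vertex,
-- so Σ μ ≤ 6k < 6m.  A minimum cover is no larger than the star at the root together with,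
-- for each interior vertex v, a pair of leaves below the two children of v; that cover has at
-- most m + k pairs, so Σ μ = 2|𝒯| ≤ 2(m + k) < 4m.  In both cases some leaf is below average.

module Submission where

open import Defs
import Data.Bool as Bool
open import Data.Bool using (Bool; true; false; _∧_; _∨_; not; if_then_else_)
open import Data.Bool.Properties using (T-≡; ∨-comm; ∧-comm; ¬-not; ∨-conicalˡ; ∨-conicalʳ)
open import Data.Empty using (⊥; ⊥-elim)
open import Data.Fin using (Fin; zero; suc; toℕ; _≟_; punchIn; punchOut; join; splitAt)
open import Data.Fin.Properties
  using (any?; toℕ-injective; punchInᵢ≢i; punchIn-injective; punchIn-punchOut; punchOut-injective;
         splitAt-join; join-splitAt; injective⇒≤)
open import Data.List using (List; []; _∷_; _++_; length; tabulate; map; allFin)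
open import Data.List.Properties using (length-++)
open import Data.List.Relation.Unary.All using (All; []; _∷_)
import Data.List.Relation.Unary.All as All
import Data.List.Relation.Unary.All.Properties as AllP
open import Data.List.Relation.Unary.AllPairs using (AllPairs; []; _∷_)
import Data.List.Relation.Unary.AllPairs.Properties as APP
open import Data.List.Relation.Unary.Linked using (Linked; []; [-]; _∷_)
open import Data.Nat using (ℕ; zero; suc; _+_; _*_; _≤_; _<_; z≤n; s≤s; _<ᵇ_)
import Data.Nat.ListAction as List
open import Data.Nat.Properties hiding (_≟_)
open import Algebra.Properties.CommutativeMonoid.Sum +-0-commutativeMonoid
  using (sum-syntax; ∑-distrib-+; ∑-comm; sum-cong-≗)
open import Data.Product using (_×_; _,_; proj₁; proj₂; uncurry; ∃; ∃-syntax)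
open import Data.Sum using (_⊎_; inj₁; inj₂; [_,_]; [_,_]′; reduce)
open import Data.Sum.Properties using (≡-dec; inj₁-injective; inj₂-injective)
open import Data.Unit using (⊤)
open import Function using (_∘_; id; Equivalence; mk⇔)
open import Relation.Binary.Definitions using (DecidableEquality; tri<; tri≈; tri>)
open import Relation.Binary.PropositionalEquality
  using (_≡_; _≢_; refl; sym; trans; cong; cong₂; subst; module ≡-Reasoning)
open import Relation.Nullary using (¬_; Dec; yes; no; does; contradiction)
open import Relation.Nullary.Decidable
  using (T?; map′; _⊎-dec_; _×-dec_; ¬?; dec-true; dec-false; does-⇔; isYes≗does)

𝟙 : Bool → ℕ
𝟙 b = if b then 1 else 0

-- Unlike ⌊ x ≟ y ⌋ (= isYes), does (suc x ≟ suc y) reduces to does (x ≟ y).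
infix 7 _≡ᵇ_
_≡ᵇ_ : ∀ {n} → Fin n → Fin n → Bool
x ≡ᵇ y = does (x ≟ y)

does⇒ : ∀ {A : Set} (a? : Dec A) → does a? ≡ true → A
does⇒ (yes a) _ = a

𝟙-∨ : ∀ a b → 𝟙 (a ∨ b) ≤ 𝟙 a + 𝟙 b
𝟙-∨ true  b = s≤s z≤n
𝟙-∨ false b = ≤-refl

∑-mono-≤ : ∀ {n} {f g : Fin n → ℕ} → (∀ i → f i ≤ g i) → ∑[ i < n ] f i ≤ ∑[ i < n ] g i
∑-mono-≤ {zero}  f≤g = z≤n
∑-mono-≤ {suc n} f≤g = +-mono-≤ (f≤g zero) (∑-mono-≤ (f≤g ∘ suc))

∑-const : ∀ n c → ∑[ i < n ] c ≡ n * c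
∑-const zero    c = refl
∑-const (suc n) c = cong (c +_) (∑-const n c)

term≤∑ : ∀ {n} (f : Fin n → ℕ) i → f i ≤ ∑[ j < n ] f j
term≤∑ f zero    = m≤m+n _ _
term≤∑ f (suc i) = ≤-trans (term≤∑ (f ∘ suc) i) (m≤n+m _ _)

∑<⇒∃≤ : ∀ {n} (f : Fin n → ℕ) c → ∑[ i < n ] f i < n * suc c → ∃[ i ] f i ≤ c
∑<⇒∃≤ {n} f c ∑f<n[1+c] with any? (λ i → f i ≤? c)
... | yes small = small
... | no ¬small = contradiction ∑f<n[1+c] (≤⇒≯ (begin
      n * suc c           ≡⟨ ∑-const n (suc c) ⟨
      ∑[ i < n ] suc c    ≤⟨ ∑-mono-≤ (λ i → ≰⇒> (λ fi≤c → ¬small (i , fi≤c))) ⟩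
      ∑[ i < n ] f i      ∎))
  where open ≤-Reasoning

𝟙≤∑𝟙 : ∀ {n} {b} (f : Fin n → Bool) → (b ≡ true → ∃[ j ] f j ≡ true) → 𝟙 b ≤ ∑[ j < n ] 𝟙 (f j)
𝟙≤∑𝟙 {b = false} f witness = z≤n
𝟙≤∑𝟙 {n} {b = true} f witness with witness refl
... | j , fj≡true = subst (λ c → 𝟙 c ≤ ∑[ i < n ] 𝟙 (f i)) fj≡true (term≤∑ (𝟙 ∘ f) j)

∑-𝟙-≡ᵇ : ∀ {n} (a : Fin n) → ∑[ j < n ] 𝟙 (j ≡ᵇ a) ≡ 1
∑-𝟙-≡ᵇ {suc n} zero    = cong suc (trans (∑-const n 0) (*-zeroʳ n))
∑-𝟙-≡ᵇ {suc n} (suc a) = ∑-𝟙-≡ᵇ a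

∑-𝟙-∧-≡ᵇ : ∀ {n} c (b : Fin n) → ∑[ y < n ] 𝟙 (c ∧ y ≡ᵇ b) ≡ 𝟙 c
∑-𝟙-∧-≡ᵇ     true  b = ∑-𝟙-≡ᵇ b
∑-𝟙-∧-≡ᵇ {n} false b = trans (∑-const n 0) (*-zeroʳ n)

count-tabulate : ∀ {A : Set} {n} (p : A → Bool) (f : Fin n → A) →
  count p (tabulate f) ≡ ∑[ i < n ] 𝟙 (p (f i))
count-tabulate {n = zero}  p f = refl
count-tabulate {n = suc n} p f = cong (𝟙 (p (f zero)) +_) (count-tabulate p (f ∘ suc))

sum-map-tabulate : ∀ {A : Set} {n} (g : A → ℕ) (f : Fin n → A) →
  List.sum (map g (tabulate f)) ≡ ∑[ i < n ] g (f i)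
sum-map-tabulate {n = zero}  g f = refl
sum-map-tabulate {n = suc n} g f = cong (g (f zero) +_) (sum-map-tabulate g (f ∘ suc))

pigeonhole-3-2 : ∀ {A : Set} {p q a b c : A} →
  a ≡ p ⊎ a ≡ q → b ≡ p ⊎ b ≡ q → c ≡ p ⊎ c ≡ q → a ≡ b ⊎ a ≡ c ⊎ b ≡ c
pigeonhole-3-2 (inj₁ refl) (inj₁ refl) _           = inj₁ refl
pigeonhole-3-2 (inj₂ refl) (inj₂ refl) _           = inj₁ refl
pigeonhole-3-2 (inj₁ refl) (inj₂ refl) (inj₁ refl) = inj₂ (inj₁ refl)
pigeonhole-3-2 (inj₁ refl) (inj₂ refl) (inj₂ refl) = inj₂ (inj₂ refl)
pigeonhole-3-2 (inj₂ refl) (inj₁ refl) (inj₁ refl) = inj₂ (inj₂ refl)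
pigeonhole-3-2 (inj₂ refl) (inj₁ refl) (inj₂ refl) = inj₂ (inj₁ refl)

third-element : ∀ {m} → 3 ≤ m → (x y : Fin m) → ∃[ z ] z ≢ x × z ≢ y
third-element (s≤s (s≤s (s≤s _))) x y with x ≟ y
... | yes refl = punchIn x zero , punchInᵢ≢i x zero , punchInᵢ≢i x zero
... | no x≢y   = punchIn x (punchIn y′ zero) , punchInᵢ≢i x _ , z≢y
  where
  y′ = punchOut x≢y
  z≢y : punchIn x (punchIn y′ zero) ≢ y
  z≢y eq = punchInᵢ≢i y′ zero (punchIn-injective x _ _ (trans eq (sym (punchIn-punchOut x≢y))))

minimal-witness : ∀ {P : ℕ → Set} → (∀ n → Dec (P n)) → ∀ {n} → P n →
  ∃[ d ] P d × (∀ {i} → P i → d ≤ i)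
minimal-witness P? {zero}  p₀ = 0 , p₀ , λ _ → z≤n
minimal-witness {P} P? {suc n} pₙ with P? 0
... | yes p₀ = 0 , p₀ , λ _ → z≤n
... | no ¬p₀ with minimal-witness (P? ∘ suc) pₙ
...   | d , p-d , minimal = suc d , p-d , minimal′
  where
  minimal′ : ∀ {i} → P i → suc d ≤ i
  minimal′ {zero}  p₀ = contradiction p₀ ¬p₀
  minimal′ {suc i} pᵢ = s≤s (minimal pᵢ)

linked-snoc : ∀ {A : Set} {R : A → A → Set} (xs : List A) {y z} →
  Linked R (xs ++ y ∷ []) → R y z → Linked R ((xs ++ y ∷ []) ++ z ∷ [])
linked-snoc []           [-]        y~z = y~z ∷ [-]
linked-snoc (_ ∷ [])     (r ∷ rs)   y~z = r ∷ linked-snoc [] rs y~z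
linked-snoc (_ ∷ x ∷ xs) (r ∷ rs)   y~z = r ∷ linked-snoc (x ∷ xs) rs y~z

module _ {m : ℕ} where

  mult-∑ : (R : PairRel m) (x : Fin m) → mult R x ≡ ∑[ y < m ] 𝟙 (R x y)
  mult-∑ R x = count-tabulate (R x) id

  degreeSum : PairRel m → ℕ
  degreeSum R = ∑[ x < m ] mult R x

  degreeSum-∑∑ : (R : PairRel m) → degreeSum R ≡ ∑[ x < m ] ∑[ y < m ] 𝟙 (R x y)
  degreeSum-∑∑ R = sum-cong-≗ (mult-∑ R)

  size-∑∑ : (P : PairRel m) → size P ≡ ∑[ x < m ] ∑[ y < m ] 𝟙 ((toℕ x <ᵇ toℕ y) ∧ P x y)
  size-∑∑ P =
    trans (sum-map-tabulate (λ x → count (λ y → (toℕ x <ᵇ toℕ y) ∧ P x y) (allFin m)) id)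
          (sum-cong-≗ (λ x → count-tabulate (λ y → (toℕ x <ᵇ toℕ y) ∧ P x y) id))

  degreeSum-cover : ∀ {n} (P : PairRel m) (R : Fin n → PairRel m) →
    (∀ x y → P x y ≡ true → ∃[ j ] R j x y ≡ true) →
    degreeSum P ≤ ∑[ j < n ] degreeSum (R j)
  degreeSum-cover {n} P R covered = begin
    degreeSum P
      ≡⟨ degreeSum-∑∑ P ⟩
    ∑[ x < m ] ∑[ y < m ] 𝟙 (P x y)
      ≤⟨ ∑-mono-≤ (λ x → ∑-mono-≤ (λ y → 𝟙≤∑𝟙 (λ j → R j x y) (covered x y))) ⟩
    ∑[ x < m ] ∑[ y < m ] ∑[ j < n ] 𝟙 (R j x y)
      ≡⟨ sum-cong-≗ (λ x → ∑-comm (λ y j → 𝟙 (R j x y))) ⟩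
    ∑[ x < m ] ∑[ j < n ] ∑[ y < m ] 𝟙 (R j x y)
      ≡⟨ ∑-comm (λ x j → ∑[ y < m ] 𝟙 (R j x y)) ⟩
    ∑[ j < n ] ∑[ x < m ] ∑[ y < m ] 𝟙 (R j x y)
      ≡⟨ sum-cong-≗ (λ j → degreeSum-∑∑ (R j)) ⟨
    ∑[ j < n ] degreeSum (R j)
      ∎
    where open ≤-Reasoning

  degreeSum-∪ : (R S : PairRel m) → degreeSum (λ x y → R x y ∨ S x y) ≤ degreeSum R + degreeSum S
  degreeSum-∪ R S = begin
    degreeSum (λ x y → R x y ∨ S x y)
      ≡⟨ degreeSum-∑∑ (λ x y → R x y ∨ S x y) ⟩
    ∑[ x < m ] ∑[ y < m ] 𝟙 (R x y ∨ S x y)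
      ≤⟨ ∑-mono-≤ (λ x → ∑-mono-≤ (λ y → 𝟙-∨ (R x y) (S x y))) ⟩
    ∑[ x < m ] ∑[ y < m ] (𝟙 (R x y) + 𝟙 (S x y))
      ≡⟨ sum-cong-≗ (λ x → ∑-distrib-+ (λ y → 𝟙 (R x y)) (λ y → 𝟙 (S x y))) ⟩
    ∑[ x < m ] (∑[ y < m ] 𝟙 (R x y) + ∑[ y < m ] 𝟙 (S x y))
      ≡⟨ ∑-distrib-+ (λ x → ∑[ y < m ] 𝟙 (R x y)) (λ x → ∑[ y < m ] 𝟙 (S x y)) ⟩
    ∑[ x < m ] ∑[ y < m ] 𝟙 (R x y) + ∑[ x < m ] ∑[ y < m ] 𝟙 (S x y)
      ≡⟨ cong₂ _+_ (degreeSum-∑∑ R) (degreeSum-∑∑ S) ⟨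
    degreeSum R + degreeSum S
      ∎
    where open ≤-Reasoning

  2≤mult : (R : PairRel m) {x b c : Fin m} → b ≢ c → R x b ≡ true → R x c ≡ true → 2 ≤ mult R x
  2≤mult R {x} {b} {c} b≢c xb xc = begin
    2
      ≡⟨ cong₂ _+_ (∑-𝟙-≡ᵇ b) (∑-𝟙-≡ᵇ c) ⟨
    ∑[ y < m ] 𝟙 (y ≡ᵇ b) + ∑[ y < m ] 𝟙 (y ≡ᵇ c)
      ≡⟨ ∑-distrib-+ (λ y → 𝟙 (y ≡ᵇ b)) (λ y → 𝟙 (y ≡ᵇ c)) ⟨
    ∑[ y < m ] (𝟙 (y ≡ᵇ b) + 𝟙 (y ≡ᵇ c))
      ≤⟨ ∑-mono-≤ indicators≤ ⟩
    ∑[ y < m ] 𝟙 (R x y)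
      ≡⟨ mult-∑ R x ⟨
    mult R x
      ∎
    where
    open ≤-Reasoning
    indicators≤ : ∀ y → 𝟙 (y ≡ᵇ b) + 𝟙 (y ≡ᵇ c) ≤ 𝟙 (R x y)
    indicators≤ y with y ≟ b | y ≟ c
    ... | yes refl | yes refl = contradiction refl b≢c
    ... | yes refl | no _     = subst (λ r → 1 ≤ 𝟙 r) (sym xb) ≤-refl
    ... | no _     | yes refl = subst (λ r → 1 ≤ 𝟙 r) (sym xc) ≤-refl
    ... | no _     | no _     = z≤n

  degreeSum-handshake : (P : PairRel m) → IsPairSet P → degreeSum P ≡ size P + size P
  degreeSum-handshake P (P-sym , P-irrefl) = begin
    degreeSum P
      ≡⟨ degreeSum-∑∑ P ⟩
    ∑[ x < m ] ∑[ y < m ] 𝟙 (P x y)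
      ≡⟨ sum-cong-≗ (λ x → trans (sum-cong-≗ (split x)) (∑-distrib-+ (Up x) (Down x))) ⟩
    ∑[ x < m ] (∑[ y < m ] Up x y + ∑[ y < m ] Down x y)
      ≡⟨ ∑-distrib-+ (λ x → ∑[ y < m ] Up x y) (λ x → ∑[ y < m ] Down x y) ⟩
    ∑[ x < m ] ∑[ y < m ] Up x y + ∑[ x < m ] ∑[ y < m ] Down x y
      ≡⟨ cong (∑[ x < m ] ∑[ y < m ] Up x y +_) (∑-comm Down) ⟩
    ∑[ x < m ] ∑[ y < m ] Up x y + ∑[ y < m ] ∑[ x < m ] Down x y
      ≡⟨ cong (∑[ x < m ] ∑[ y < m ] Up x y +_)
              (sum-cong-≗ (λ y → sum-cong-≗ (λ x → cong (λ b → 𝟙 (lt y x ∧ b)) (P-sym x y)))) ⟩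
    ∑[ x < m ] ∑[ y < m ] Up x y + ∑[ y < m ] ∑[ x < m ] Up y x
      ≡⟨ cong₂ _+_ (size-∑∑ P) (size-∑∑ P) ⟨
    size P + size P
      ∎
    where
    open ≡-Reasoning
    lt : Fin m → Fin m → Bool
    lt x y = toℕ x <ᵇ toℕ y
    Up Down : Fin m → Fin m → ℕ
    Up   x y = 𝟙 (lt x y ∧ P x y)
    Down x y = 𝟙 (lt y x ∧ P x y)
    <ᵇ-true : ∀ {i j} → i < j → (i <ᵇ j) ≡ true
    <ᵇ-true i<j = Equivalence.to T-≡ (<⇒<ᵇ i<j)
    <ᵇ-false : ∀ {i j} → ¬ i < j → (i <ᵇ j) ≡ false
    <ᵇ-false {i} {j} i≮j = dec-false (T? (i <ᵇ j)) (i≮j ∘ <ᵇ⇒< i j)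
    split : ∀ x y → 𝟙 (P x y) ≡ Up x y + Down x y
    split x y with <-cmp (toℕ x) (toℕ y)
    ... | tri< x<y _ y≮x rewrite <ᵇ-true x<y | <ᵇ-false y≮x = sym (+-identityʳ _)
    ... | tri> x≮y _ y<x rewrite <ᵇ-false x≮y | <ᵇ-true y<x = refl
    ... | tri≈ x≮y x≡y y≮x rewrite <ᵇ-false x≮y | <ᵇ-false y≮x | toℕ-injective x≡y | P-irrefl y = refl

  pair : Fin m → Fin m → PairRel m
  pair a b x y = (x ≡ᵇ a ∧ y ≡ᵇ b) ∨ (x ≡ᵇ b ∧ y ≡ᵇ a)

  pair-comm : (a b x y : Fin m) → pair a b x y ≡ pair a b y x
  pair-comm a b x y = trans (∨-comm (x ≡ᵇ a ∧ y ≡ᵇ b) (x ≡ᵇ b ∧ y ≡ᵇ a))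
                            (cong₂ _∨_ (∧-comm (x ≡ᵇ b) (y ≡ᵇ a)) (∧-comm (x ≡ᵇ a) (y ≡ᵇ b)))

  ≡ᵇ-sym : (u v : Fin m) → u ≡ᵇ v ≡ v ≡ᵇ u
  ≡ᵇ-sym u v = does-⇔ (mk⇔ sym sym) (u ≟ v) (v ≟ u)

  pair-swap : (a b x y : Fin m) → pair a b x y ≡ pair x y a b
  pair-swap a b x y rewrite ≡ᵇ-sym a x | ≡ᵇ-sym b y | ≡ᵇ-sym a y | ≡ᵇ-sym b x =
    cong (x ≡ᵇ a ∧ y ≡ᵇ b ∨_) (∧-comm (x ≡ᵇ b) (y ≡ᵇ a))

  pair-self : (a b : Fin m) → pair a b a b ≡ true
  pair-self a b rewrite dec-true (a ≟ a) refl | dec-true (b ≟ b) refl = refl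

  mult-pair : (a b x : Fin m) → mult (pair a b) x ≤ 𝟙 (x ≡ᵇ a) + 𝟙 (x ≡ᵇ b)
  mult-pair a b x = begin
    mult (pair a b) x
      ≡⟨ mult-∑ (pair a b) x ⟩
    ∑[ y < m ] 𝟙 (pair a b x y)
      ≤⟨ ∑-mono-≤ (λ y → 𝟙-∨ (x ≡ᵇ a ∧ y ≡ᵇ b) (x ≡ᵇ b ∧ y ≡ᵇ a)) ⟩
    ∑[ y < m ] (𝟙 (x ≡ᵇ a ∧ y ≡ᵇ b) + 𝟙 (x ≡ᵇ b ∧ y ≡ᵇ a))
      ≡⟨ ∑-distrib-+ (λ y → 𝟙 (x ≡ᵇ a ∧ y ≡ᵇ b)) (λ y → 𝟙 (x ≡ᵇ b ∧ y ≡ᵇ a)) ⟩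
    ∑[ y < m ] 𝟙 (x ≡ᵇ a ∧ y ≡ᵇ b) + ∑[ y < m ] 𝟙 (x ≡ᵇ b ∧ y ≡ᵇ a)
      ≡⟨ cong₂ _+_ (∑-𝟙-∧-≡ᵇ (x ≡ᵇ a) b) (∑-𝟙-∧-≡ᵇ (x ≡ᵇ b) a) ⟩
    𝟙 (x ≡ᵇ a) + 𝟙 (x ≡ᵇ b)
      ∎
    where open ≤-Reasoning

  degreeSum-pair : (a b : Fin m) → degreeSum (pair a b) ≤ 2
  degreeSum-pair a b = begin
    degreeSum (pair a b)
      ≤⟨ ∑-mono-≤ (mult-pair a b) ⟩
    ∑[ x < m ] (𝟙 (x ≡ᵇ a) + 𝟙 (x ≡ᵇ b))
      ≡⟨ ∑-distrib-+ (λ x → 𝟙 (x ≡ᵇ a)) (λ x → 𝟙 (x ≡ᵇ b)) ⟩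
    ∑[ x < m ] 𝟙 (x ≡ᵇ a) + ∑[ x < m ] 𝟙 (x ≡ᵇ b)
      ≡⟨ cong₂ _+_ (∑-𝟙-≡ᵇ a) (∑-𝟙-≡ᵇ b) ⟩
    2
      ∎
    where open ≤-Reasoning

  triangle : Fin m → Fin m → Fin m → PairRel m
  triangle a b c x y = pair a b x y ∨ pair a c x y ∨ pair b c x y

  degreeSum-triangle : (a b c : Fin m) → degreeSum (triangle a b c) ≤ 6
  degreeSum-triangle a b c = begin
    degreeSum (triangle a b c)
      ≤⟨ degreeSum-∪ (pair a b) (λ x y → pair a c x y ∨ pair b c x y) ⟩
    degreeSum (pair a b) + degreeSum (λ x y → pair a c x y ∨ pair b c x y)
      ≤⟨ +-monoʳ-≤ (degreeSum (pair a b)) (degreeSum-∪ (pair a c) (pair b c)) ⟩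
    degreeSum (pair a b) + (degreeSum (pair a c) + degreeSum (pair b c))
      ≤⟨ +-mono-≤ (degreeSum-pair a b) (+-mono-≤ (degreeSum-pair a c) (degreeSum-pair b c)) ⟩
    6
      ∎
    where open ≤-Reasoning

  removePair-pair : (P : PairRel m) (a b x y : Fin m) → removePair P a b x y ≡ P x y ∧ not (pair a b x y)
  removePair-pair P a b x y
    rewrite isYes≗does (x ≟ a) | isYes≗does (y ≟ b) | isYes≗does (x ≟ b) | isYes≗does (y ≟ a) = refl

  removePair-keeps : (P : PairRel m) {a b x y : Fin m} → P x y ≡ true → pair x y a b ≡ false →
    removePair P a b x y ≡ true
  removePair-keeps P {a} {b} {x} {y} xy not-ab
    rewrite removePair-pair P a b x y | xy | pair-swap a b x y | not-ab = refl

  -- Loops are excluded explicitly, so spanned e is a pair set even if some e j is degenerate.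
  Spanned : ∀ {n} → (Fin n → Fin m × Fin m) → Fin m → Fin m → Set
  Spanned e x y = x ≢ y × ∃[ j ] uncurry pair (e j) x y ≡ true

  spanned? : ∀ {n} (e : Fin n → Fin m × Fin m) x y → Dec (Spanned e x y)
  spanned? e x y = ¬? (x ≟ y) ×-dec any? (λ j → uncurry pair (e j) x y Bool.≟ true)

  spanned : ∀ {n} → (Fin n → Fin m × Fin m) → PairRel m
  spanned e x y = does (spanned? e x y)

  spanned-isPairSet : ∀ {n} (e : Fin n → Fin m × Fin m) → IsPairSet (spanned e)
  spanned-isPairSet e = (λ x y → does-⇔ (mk⇔ flip flip) (spanned? e x y) (spanned? e y x))
                      , (λ x → dec-false (spanned? e x x) (λ (x≢x , _) → x≢x refl))
    where
    flip : ∀ {x y} → Spanned e x y → Spanned e y x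
    flip {x} {y} (x≢y , j , xy) =
      x≢y ∘ sym , j , trans (sym (pair-comm (proj₁ (e j)) (proj₂ (e j)) x y)) xy

  spanned-∋ : ∀ {n} (e : Fin n → Fin m × Fin m) j {a b} → e j ≡ (a , b) → a ≢ b → spanned e a b ≡ true
  spanned-∋ e j {a} {b} e-j a≢b =
    dec-true (spanned? e a b) (a≢b , j , subst (λ ab → uncurry pair ab a b ≡ true) (sym e-j) (pair-self a b))

  degreeSum-spanned : ∀ {n} (e : Fin n → Fin m × Fin m) → degreeSum (spanned e) ≤ n * 2
  degreeSum-spanned {n} e = begin
    degreeSum (spanned e)
      ≤⟨ degreeSum-cover (spanned e) (uncurry pair ∘ e) (λ x y xy → proj₂ (does⇒ (spanned? e x y) xy)) ⟩
    ∑[ j < n ] degreeSum (uncurry pair (e j))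
      ≤⟨ ∑-mono-≤ (λ j → degreeSum-pair (proj₁ (e j)) (proj₂ (e j))) ⟩
    ∑[ j < n ] 2
      ≡⟨ ∑-const n 2 ⟩
    n * 2
      ∎
    where open ≤-Reasoning

_≟ᵥ_ : ∀ {m k} → DecidableEquality (Vtx m k)
_≟ᵥ_ = ≡-dec _≟_ _≟_

any-vertex? : ∀ {m k} {P : Vtx m k → Set} → (∀ v → Dec (P v)) → Dec (∃ P)
any-vertex? P? = map′ [ (λ (i , p) → inj₁ i , p) , (λ (j , p) → inj₂ j , p) ]
                      (λ { (inj₁ i , p) → inj₁ (i , p) ; (inj₂ j , p) → inj₂ (j , p) })
                      (any? (P? ∘ inj₁) ⊎-dec any? (P? ∘ inj₂))

module _ {m k : ℕ} {E : Adj m k} where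

  walk-start : ∀ {ok u v} → Walk E ok u v → ok u
  walk-start (here ok-u)     = ok-u
  walk-start (step ok-u _ _) = ok-u

  walk-++ : ∀ {ok u v w} → Walk E ok u v → Walk E ok v w → Walk E ok u w
  walk-++ (here _)         q = q
  walk-++ (step ok-u e p)  q = step ok-u e (walk-++ p q)

  walk-reverse : (∀ u v → E u v ≡ E v u) → ∀ {ok u v} → Walk E ok u v → Walk E ok v u
  walk-reverse E-sym (here ok-u)    = here ok-u
  walk-reverse E-sym (step ok-u e p) =
    walk-++ (walk-reverse E-sym p) (step (walk-start p) (trans (E-sym _ _) e) (here ok-u))

  walk-preserves : ∀ {ok} (I : Vtx m k → Set) → (∀ {a b} → I a → E a b ≡ true → ok b → I b) →
    ∀ {s t} → Walk E ok s t → I s → I t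
  walk-preserves I step-I (here _)     I-s = I-s
  walk-preserves I step-I (step _ e p) I-s = walk-preserves I step-I p (step-I I-s e (walk-start p))

  walk-last-step : ∀ {ok s t} → Walk E ok s t → s ≢ t → ∃[ w ] ok w × E w t ≡ true
  walk-last-step (here _)        s≢t = contradiction refl s≢t
  walk-last-step (step ok-s e p) _   = last ok-s e p
    where
    last : ∀ {ok s w t} → ok s → E s w ≡ true → Walk E ok w t → ∃[ v ] ok v × E v t ≡ true
    last {s = s} ok-s e (here _)        = s , ok-s , e
    last _       _ (step ok-w e′ q)    = last ok-w e′ q

  walk-until : ∀ {ok s t} → Walk E ok s t → s ≢ t → ∃[ w ] E w t ≡ true × Walk E (_≢ t) s w
  walk-until (here _) s≢t = contradiction refl s≢t
  walk-until {t = t} (step {u = s} {w = s′} _ e p) s≢t with s′ ≟ᵥ t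
  ... | yes refl  = s , e , here s≢t
  ... | no s′≢t with walk-until p s′≢t
  ...   | w , w~t , q = w , w~t , step s≢t e q

  other-neighbours : ∀ {v z} → Degree3 E v → E v z ≡ true →
    ∃[ p ] ∃[ q ] p ≢ q × p ≢ z × q ≢ z × E v p ≡ true × E v q ≡ true
                  × (∀ u → E v u ≡ true → u ≢ z → u ≡ p ⊎ u ≡ q)
  other-neighbours (n₁ , n₂ , n₃ , (n₁≢n₂ , n₁≢n₃ , n₂≢n₃) , (e₁ , e₂ , e₃) , only) v~z with only _ v~z
  ... | inj₁ refl        = n₂ , n₃ , n₂≢n₃ , n₁≢n₂ ∘ sym , n₁≢n₃ ∘ sym , e₂ , e₃ , λ u v~u u≢z →
                             [ (λ u≡z → contradiction u≡z u≢z) , id ] (only u v~u)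
  ... | inj₂ (inj₁ refl) = n₁ , n₃ , n₁≢n₃ , n₁≢n₂ , n₂≢n₃ ∘ sym , e₁ , e₃ , λ u v~u u≢z →
                             [ inj₁ , [ (λ u≡z → contradiction u≡z u≢z) , inj₂ ] ] (only u v~u)
  ... | inj₂ (inj₂ refl) = n₁ , n₂ , n₁≢n₂ , n₁≢n₃ , n₂≢n₃ , e₁ , e₂ , λ u v~u u≢z →
                             [ inj₁ , [ inj₂ , (λ u≡z → contradiction u≡z u≢z) ] ] (only u v~u)

Separated : ∀ {m k} → BinaryPhyloTree m k → Fin k → Fin m → Fin m → Set
Separated T i a b = ¬ Walk (adj T) (_≢ inj₂ i) (inj₁ a) (inj₁ b)

module _ {m k : ℕ} (T : BinaryPhyloTree m k) where

  private
    E = adj T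

  separated⇒≢ : ∀ {i a b} → Separated T i a b → a ≢ b
  separated⇒≢ a|b refl = a|b (here λ ())

  leaf-neighbours-equal : ∀ {x u w} → E (inj₁ x) u ≡ true → E (inj₁ x) w ≡ true → u ≡ w
  leaf-neighbours-equal {x} x~u x~w with leaf-deg T x
  ... | _ , only , _ = trans (only _ x~u) (sym (only _ x~w))

  leaves-nonadjacent : 3 ≤ m → ∀ {x y} → E (inj₁ x) (inj₁ y) ≢ true
  leaves-nonadjacent 3≤m {x} {y} x~y with third-element 3≤m x y
  ... | z , z≢x , z≢y =
    [ z≢x ∘ inj₁-injective , z≢y ∘ inj₁-injective ]
      (walk-preserves XY closed (connected T (inj₁ x) (inj₁ z)) (inj₁ refl))
    where
    XY : Vtx m k → Set
    XY w = w ≡ inj₁ x ⊎ w ≡ inj₁ y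
    closed : ∀ {a b} → XY a → E a b ≡ true → ⊤ → XY b
    closed (inj₁ refl) x~b _ = inj₂ (leaf-neighbours-equal x~b x~y)
    closed (inj₂ refl) y~b _ = inj₁ (leaf-neighbours-equal y~b (trans (adj-sym T _ _) x~y))

  leaf-neighbour-interior : 3 ≤ m → ∀ x → ∃[ i ] E (inj₁ x) (inj₂ i) ≡ true
  leaf-neighbour-interior 3≤m x with leaf-deg T x
  ... | inj₂ i , _ , x~i = i , x~i
  ... | inj₁ y , _ , x~y = contradiction x~y (leaves-nonadjacent 3≤m)

  leaf-outside-separated-triple : ∀ {x i a b c} → E (inj₁ x) (inj₂ i) ≡ true → a ≢ x → b ≢ x → c ≢ x →
    Separated T i a b → Separated T i a c → Separated T i b c → ⊥
  leaf-outside-separated-triple {x} {i} {a} {b} {c} x~i a≢x b≢x c≢x a|b a|c b|c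
    with other-neighbours {E = E} (int-deg T i) (trans (adj-sym T _ _) x~i)
  ... | p , q , _ , _ , _ , _ , _ , sides =
    refute (pigeonhole-3-2 (proj₂ (proj₂ A)) (proj₂ (proj₂ B)) (proj₂ (proj₂ C)))
    where
    Avoiding = Walk E (_≢ inj₂ i)
    branch : ∀ l → l ≢ x → ∃[ w ] Avoiding (inj₁ l) w × (w ≡ p ⊎ w ≡ q)
    branch l l≢x with walk-until (connected T (inj₁ l) (inj₂ i)) (λ ())
    ... | w , w~i , l⇝w = w , l⇝w , sides w (trans (adj-sym T _ _) w~i) w≢x
      where
      w≢x : w ≢ inj₁ x
      w≢x refl with walk-last-step l⇝w (l≢x ∘ inj₁-injective)
      ... | v , v≢i , v~x = v≢i (leaf-neighbours-equal (trans (adj-sym T _ _) v~x) x~i)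
    A = branch a a≢x
    B = branch b b≢x
    C = branch c c≢x
    joined : ∀ {l l′ w w′} → Avoiding (inj₁ l) w → Avoiding (inj₁ l′) w′ → w ≡ w′ →
             Avoiding (inj₁ l) (inj₁ l′)
    joined l⇝w l′⇝w refl = walk-++ l⇝w (walk-reverse (adj-sym T) l′⇝w)
    refute : proj₁ A ≡ proj₁ B ⊎ proj₁ A ≡ proj₁ C ⊎ proj₁ B ≡ proj₁ C → ⊥
    refute (inj₁ A≡B)        = a|b (joined (proj₁ (proj₂ A)) (proj₁ (proj₂ B)) A≡B)
    refute (inj₂ (inj₁ A≡C)) = a|c (joined (proj₁ (proj₂ A)) (proj₁ (proj₂ C)) A≡C)
    refute (inj₂ (inj₂ B≡C)) = b|c (joined (proj₁ (proj₂ B)) (proj₁ (proj₂ C)) B≡C)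

  mult≥2 : 3 ≤ m → (P : PairRel m) → IsPairSet P → IsTripletCover T P → ∀ x → 2 ≤ mult P x
  mult≥2 3≤m P (P-sym , _) cover x with leaf-neighbour-interior 3≤m x
  ... | i , x~i with cover i
  ... | a , b , c , (a|b , a|c , b|c) , (ab , ac , bc) with a ≟ x | b ≟ x | c ≟ x
  ... | yes refl | _        | _        = 2≤mult P (separated⇒≢ b|c) ab ac
  ... | no _     | yes refl | _        = 2≤mult P (separated⇒≢ a|c) (trans (P-sym x a) ab) bc
  ... | no _     | no _     | yes refl = 2≤mult P (separated⇒≢ a|b) (trans (P-sym x a) ac) (trans (P-sym x b) bc)
  ... | no a≢x   | no b≢x   | no c≢x   =
    ⊥-elim (leaf-outside-separated-triple x~i a≢x b≢x c≢x a|b a|c b|c)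

module Rooted {m k : ℕ} (T : BinaryPhyloTree m k) (r₀ : Fin m) where

  private
    V = Vtx m k
    E = adj T

  root : V
  root = inj₁ r₀

  Near : ℕ → V → Set
  Near zero    v = v ≡ root
  Near (suc n) v = Near n v ⊎ ∃[ w ] Near n w × E w v ≡ true

  near? : ∀ n v → Dec (Near n v)
  near? zero    v = v ≟ᵥ root
  near? (suc n) v = near? n v ⊎-dec any-vertex? (λ w → near? n w ×-dec (E w v Bool.≟ true))

  near-walk : ∀ {ok u v} → Walk E ok u v → ∀ {n} → Near n u → ∃[ n′ ] Near n′ v
  near-walk (here _)       near-u = _ , near-u
  near-walk (step _ u~w p) near-u = near-walk p (inj₂ (_ , near-u , u~w))

  depth-spec : ∀ v → ∃[ d ] Near d v × (∀ {i} → Near i v → d ≤ i)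
  depth-spec v = minimal-witness (λ n → near? n v) (proj₂ (near-walk (connected T root v) {0} refl))

  depth : V → ℕ
  depth v = proj₁ (depth-spec v)

  depth-near : ∀ v → Near (depth v) v
  depth-near v = proj₁ (proj₂ (depth-spec v))

  depth-minimal : ∀ {v i} → Near i v → depth v ≤ i
  depth-minimal {v} = proj₂ (proj₂ (depth-spec v))

  depth-root : depth root ≡ 0
  depth-root = n≤0⇒n≡0 (depth-minimal refl)

  depth≡0⇒root : ∀ {v} → depth v ≡ 0 → v ≡ root
  depth≡0⇒root {v} d≡0 = subst (λ d → Near d v) d≡0 (depth-near v)

  depth-adjacent : ∀ {w v} → E w v ≡ true → depth v ≤ suc (depth w)
  depth-adjacent {w} w~v = depth-minimal (inj₂ (w , depth-near w , w~v))

  Parent : V → V → Set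
  Parent p v = E v p ≡ true × suc (depth p) ≡ depth v

  parent-exists : ∀ {v} → v ≢ root → ∃[ p ] Parent p v
  parent-exists {v} v≢root with depth v in eq
  ... | zero  = contradiction (depth≡0⇒root eq) v≢root
  ... | suc d with subst (λ n → Near n v) eq (depth-near v)
  ...   | inj₁ near-d = contradiction (subst (_≤ d) eq (depth-minimal near-d)) 1+n≰n
  ...   | inj₂ (w , near-w , w~v) =
    w , trans (adj-sym T v w) w~v
      , cong suc (≤-antisym (depth-minimal near-w) (≤-pred (subst (_≤ suc (depth w)) eq (depth-adjacent w~v))))

  deep⇒≢root : ∀ {v d} → depth v ≡ suc d → v ≢ root
  deep⇒≢root v-deep refl = 1+n≢0 (trans (sym v-deep) depth-root)

  parent⇒≢root : ∀ {p v} → Parent p v → v ≢ root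
  parent⇒≢root (_ , p-v) = deep⇒≢root (sym p-v)

  deeper⇒≢ : ∀ {x y} → depth x < depth y → x ≢ y
  deeper⇒≢ x<y refl = <-irrefl refl x<y

  Adjacent : V → V → Set
  Adjacent u v = E u v ≡ true

  -- Replacing a and b by their parents either closes a cycle (equal parents) or gives the same
  -- configuration one level higher; at depth 0 both ends would be the root.
  no-deep-bridge : ∀ d {a b} (mid : List V) → depth a ≡ d → depth b ≡ d → a ≢ b →
    All (λ w → d < depth w) mid → AllPairs _≢_ mid → Linked Adjacent (b ∷ mid ++ a ∷ []) → ⊥
  no-deep-bridge zero    _ a-d b-d a≢b _ _ _ = a≢b (trans (depth≡0⇒root a-d) (sym (depth≡0⇒root b-d)))
  no-deep-bridge (suc d) {a} {b} mid a-d b-d a≢b mid-deep mid-distinct b⇝a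
    with parent-exists (deep⇒≢root a-d) | parent-exists (deep⇒≢root b-d)
  ... | pa , a~pa , pa-a | pb , b~pb , pb-b = close (pa ≟ᵥ pb)
    where
    pa-depth : depth pa ≡ d
    pa-depth = suc-injective (trans pa-a a-d)
    pb-depth : depth pb ≡ d
    pb-depth = suc-injective (trans pb-b b-d)
    path = b ∷ mid ++ a ∷ []
    path-deep : All (λ w → d < depth w) path
    path-deep = ≤-reflexive (sym b-d)
              ∷ AllP.++⁺ (All.map (<-trans (n<1+n d)) mid-deep) (≤-reflexive (sym a-d) ∷ [])
    path-distinct : AllPairs _≢_ path
    path-distinct =
      AllP.++⁺ (All.map (λ lt → deeper⇒≢ (subst (_< _) (sym b-d) lt)) mid-deep) ((a≢b ∘ sym) ∷ [])
      ∷ APP.++⁺ mid-distinct ([] ∷ [])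
                (All.map (λ lt → (deeper⇒≢ (subst (_< _) (sym a-d) lt) ∘ sym) ∷ []) mid-deep)
    climb : Linked Adjacent (pb ∷ path ++ pa ∷ [])
    climb = trans (adj-sym T pb b) b~pb ∷ linked-snoc (b ∷ mid) b⇝a a~pa
    close : Dec (pa ≡ pb) → ⊥
    close (yes pa≡pb) = acyclic T (pa ∷ path)
      ( s≤s (s≤s (subst (1 ≤_) (sym (length-++ mid)) (m≤n+m 1 (length mid))))
      , All.map (λ d<w → deeper⇒≢ (subst (_< _) (sym pa-depth) d<w)) path-deep ∷ path-distinct
      , subst (λ p → Linked Adjacent (p ∷ path ++ pa ∷ [])) (sym pa≡pb) climb )
    close (no pa≢pb) = no-deep-bridge d path pa-depth pb-depth pa≢pb path-deep path-distinct climb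

  parent-unique : ∀ {p q v} → Parent p v → Parent q v → p ≡ q
  parent-unique {p} {q} {v} (v~p , p-v) (v~q , q-v) with p ≟ᵥ q
  ... | yes p≡q = p≡q
  ... | no p≢q  = ⊥-elim (no-deep-bridge (depth p) (v ∷ []) refl (suc-injective (trans q-v (sym p-v))) p≢q
                           (≤-reflexive p-v ∷ []) ([] ∷ []) (trans (adj-sym T q v) v~q ∷ v~p ∷ [-]))

  adjacent-depths-differ : ∀ {v w} → E v w ≡ true → depth v ≢ depth w
  adjacent-depths-differ {v} {w} v~w v-w = no-deep-bridge (depth v) [] refl (sym v-w) v≢w [] []
                                             (trans (adj-sym T w v) v~w ∷ [-])
    where
    v≢w : v ≢ w
    v≢w refl = contradiction (trans (sym v~w) (adj-irrefl T v)) λ ()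

  adjacent⇒parent : ∀ {v w} → E v w ≡ true → Parent w v ⊎ Parent v w
  adjacent⇒parent {v} {w} v~w with <-cmp (depth w) (depth v)
  ... | tri< w<v _ _ = inj₁ (v~w , ≤-antisym w<v (depth-adjacent (trans (adj-sym T w v) v~w)))
  ... | tri≈ _ w≡v _ = contradiction (sym w≡v) (adjacent-depths-differ v~w)
  ... | tri> _ _ v<w = inj₂ (trans (adj-sym T w v) v~w , ≤-antisym v<w (depth-adjacent v~w))

  record Children (v : V) : Set where
    field
      left right   : V
      left≢right   : left ≢ right
      left-parent  : Parent v left
      right-parent : Parent v right

  children : ∀ i → Children (inj₂ i)
  children i with parent-exists {inj₂ i} (λ ())
  ... | p , p-parent@(i~p , _) with other-neighbours {E = E} (int-deg T i) i~p
  ...   | c₁ , c₂ , c₁≢c₂ , c₁≢p , c₂≢p , i~c₁ , i~c₂ , _ =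
    record { left = c₁ ; right = c₂ ; left≢right = c₁≢c₂
           ; left-parent = child-of c₁≢p i~c₁ ; right-parent = child-of c₂≢p i~c₂ }
    where
    child-of : ∀ {c} → c ≢ p → E (inj₂ i) c ≡ true → Parent (inj₂ i) c
    child-of c≢p i~c = [ (λ c-i → contradiction (parent-unique c-i p-parent) c≢p) , id ] (adjacent⇒parent i~c)

  data Descendant (c : V) : V → Set where
    self  : Descendant c c
    child : ∀ {p v} → Parent p v → Descendant c p → Descendant c v

  descendant-depth : ∀ {c v} → Descendant c v → depth c ≤ depth v
  descendant-depth self               = ≤-refl
  descendant-depth (child (_ , p-v) d) = ≤-trans (descendant-depth d) (≤-trans (n≤1+n _) (≤-reflexive p-v))

  ancestor-unique : ∀ {c c′ v} → Descendant c v → Descendant c′ v → depth c ≡ depth c′ → c ≡ c′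
  ancestor-unique self                self                 _    = refl
  ancestor-unique self                (child (_ , p-v) d′) c≡c′ =
    contradiction (≤-trans (s≤s (descendant-depth d′)) (≤-reflexive (trans p-v c≡c′))) 1+n≰n
  ancestor-unique (child (_ , p-v) d) self                 c≡c′ =
    contradiction (≤-trans (s≤s (descendant-depth d)) (≤-reflexive (trans p-v (sym c≡c′)))) 1+n≰n
  ancestor-unique (child p-v d)       (child p′-v d′)      c≡c′ with parent-unique p-v p′-v
  ... | refl = ancestor-unique d d′ c≡c′

  descendant-root : ∀ {c} → Descendant c root → c ≡ root
  descendant-root self                = refl
  descendant-root (child (_ , p-r) _) = contradiction (trans p-r depth-root) 1+n≢0

  descendant-walk : ∀ {u c s t} → Parent u c → Descendant c s → Walk E (_≢ u) s t → Descendant c t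
  descendant-walk {u} {c} u-c c-s s⇝t = walk-preserves (Descendant c) step-down s⇝t c-s
    where
    step-down : ∀ {a b} → Descendant c a → E a b ≡ true → b ≢ u → Descendant c b
    step-down c-a a~b b≢u with adjacent⇒parent a~b
    ... | inj₂ a-b = child a-b c-a
    ... | inj₁ b-a with c-a
    ...   | self         = contradiction (parent-unique b-a u-c) b≢u
    ...   | child p-a c-p with parent-unique b-a p-a
    ...     | refl = c-p

  depth-bound : ℕ
  depth-bound = ∑[ i < m ] depth (inj₁ i) + ∑[ j < k ] depth (inj₂ j)

  depth≤bound : ∀ v → depth v ≤ depth-bound
  depth≤bound (inj₁ i) = ≤-trans (term≤∑ (depth ∘ inj₁) i) (m≤m+n _ _)
  depth≤bound (inj₂ j) = ≤-trans (term≤∑ (depth ∘ inj₂) j) (m≤n+m _ _)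

  leaf-below : ∀ c → ∃[ ℓ ] Descendant c (inj₁ ℓ)
  leaf-below c = descend depth-bound self (m≤n+m depth-bound (depth c))
    where
    descend : ∀ fuel {v} → Descendant c v → depth-bound ≤ depth v + fuel → ∃[ ℓ ] Descendant c (inj₁ ℓ)
    descend fuel       {inj₁ ℓ} c-v _     = ℓ , c-v
    descend zero       {inj₂ j} _   bound = contradiction too-deep 1+n≰n
      where
      open Children (children j)
      open ≤-Reasoning
      too-deep : suc (depth (inj₂ j)) ≤ depth (inj₂ j)
      too-deep = begin
        suc (depth (inj₂ j)) ≡⟨ proj₂ left-parent ⟩
        depth left           ≤⟨ depth≤bound left ⟩
        depth-bound          ≤⟨ bound ⟩
        depth (inj₂ j) + 0   ≡⟨ +-identityʳ _ ⟩
        depth (inj₂ j)       ∎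
    descend (suc fuel) {inj₂ j} c-v bound = descend fuel (child left-parent c-v) bound′
      where
      open Children (children j)
      bound′ : depth-bound ≤ depth left + fuel
      bound′ = ≤-trans bound (≤-reflexive (trans (+-suc _ fuel) (cong (_+ fuel) (proj₂ left-parent))))

-- Sending each interior vertex to its two children is an injection into the non-root vertices.
interior<leaves : ∀ {m k} → BinaryPhyloTree m k → Fin m → k < m
interior<leaves {suc m′} {k} T r₀ = s≤s (+-cancelʳ-≤ k k m′ (injective⇒≤ index-injective))
  where
  open Rooted T r₀
  child-of : Fin k ⊎ Fin k → Vtx (suc m′) k
  child-of (inj₁ i) = Children.left (children i)
  child-of (inj₂ i) = Children.right (children i)
  child-of-parent : ∀ e → Parent (inj₂ (reduce e)) (child-of e)
  child-of-parent (inj₁ i) = Children.left-parent (children i)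
  child-of-parent (inj₂ i) = Children.right-parent (children i)
  same-parent : ∀ {e e′} → child-of e ≡ child-of e′ → reduce e ≡ reduce e′
  same-parent {e} {e′} eq = inj₂-injective (parent-unique (child-of-parent e)
                                                         (subst (Parent _) (sym eq) (child-of-parent e′)))
  child-of-injective : ∀ {e e′} → child-of e ≡ child-of e′ → e ≡ e′
  child-of-injective {inj₁ i} {inj₁ j} eq with same-parent {inj₁ i} {inj₁ j} eq
  ... | refl = refl
  child-of-injective {inj₁ i} {inj₂ j} eq with same-parent {inj₁ i} {inj₂ j} eq
  ... | refl = contradiction eq (Children.left≢right (children i))
  child-of-injective {inj₂ i} {inj₁ j} eq with same-parent {inj₂ i} {inj₁ j} eq
  ... | refl = contradiction (sym eq) (Children.left≢right (children i))
  child-of-injective {inj₂ i} {inj₂ j} eq with same-parent {inj₂ i} {inj₂ j} eq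
  ... | refl = refl
  code : Vtx (suc m′) k → Fin (suc m′ + k)
  code = join (suc m′) k
  code-injective : ∀ {u v} → code u ≡ code v → u ≡ v
  code-injective {u} {v} eq =
    trans (sym (splitAt-join (suc m′) k u)) (trans (cong (splitAt (suc m′)) eq) (splitAt-join (suc m′) k v))
  root≢child : ∀ e → code root ≢ code (child-of e)
  root≢child e eq = parent⇒≢root (child-of-parent e) (sym (code-injective eq))
  index : Fin (k + k) → Fin (m′ + k)
  index e = punchOut (root≢child (splitAt k e))
  index-injective : ∀ {e e′} → index e ≡ index e′ → e ≡ e′
  index-injective {e} {e′} eq =
    trans (sym (join-splitAt k k e)) (trans (cong (join k k) same-child) (join-splitAt k k e′))
    where
    same-child : splitAt k e ≡ splitAt k e′
    same-child = child-of-injective {splitAt k e} {splitAt k e′} (code-injective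
                   (punchOut-injective (root≢child (splitAt k e)) (root≢child (splitAt k e′)) eq))

minimal-cover-degreeSum : ∀ {m k} (T : BinaryPhyloTree m k) (P : PairRel m) →
  IsMinimalTripletCover T P → degreeSum P ≤ k * 6
minimal-cover-degreeSum {m} {k} T P (_ , cover , minimal) = begin
  degreeSum P                                ≤⟨ degreeSum-cover P support-triangle covered ⟩
  ∑[ i < k ] degreeSum (support-triangle i)  ≤⟨ ∑-mono-≤ (λ i → degreeSum-triangle (a i) (b i) (c i)) ⟩
  ∑[ i < k ] 6                               ≡⟨ ∑-const k 6 ⟩
  k * 6                                      ∎
  where
  open ≤-Reasoning
  a b c : Fin k → Fin m
  a i = proj₁ (cover i)
  b i = proj₁ (proj₂ (cover i))
  c i = proj₁ (proj₂ (proj₂ (cover i)))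
  support : ∀ i → Supports T P i (a i) (b i) (c i)
  support i = proj₂ (proj₂ (proj₂ (cover i)))
  support-triangle : Fin k → PairRel m
  support-triangle i = triangle (a i) (b i) (c i)
  -- A pair lying in no support triangle could be removed from P, contradicting minimality.
  covered : ∀ x y → P x y ≡ true → ∃[ i ] support-triangle i x y ≡ true
  covered x y xy with any? (λ i → support-triangle i x y Bool.≟ true)
  ... | yes found = found
  ... | no none   = contradiction still-cover (minimal x y xy)
    where
    still-cover : IsTripletCover T (removePair P x y)
    still-cover i =
      a i , b i , c i , proj₁ (support i)
      , removePair-keeps P ab (∨-conicalˡ pab _ outside)
      , removePair-keeps P ac (∨-conicalˡ pac pbc (∨-conicalʳ pab _ outside))
      , removePair-keeps P bc (∨-conicalʳ pac pbc (∨-conicalʳ pab _ outside))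
      where
      pab = pair (a i) (b i) x y
      pac = pair (a i) (c i) x y
      pbc = pair (b i) (c i) x y
      outside : support-triangle i x y ≡ false
      outside = ¬-not (λ inside → none (i , inside))
      ab = proj₁ (proj₂ (support i))
      ac = proj₁ (proj₂ (proj₂ (support i)))
      bc = proj₂ (proj₂ (proj₂ (support i)))

module _ {m k : ℕ} (T : BinaryPhyloTree m k) (r₀ : Fin m) where

  open Rooted T r₀

  left-leaf right-leaf : Fin k → Fin m
  left-leaf  i = proj₁ (leaf-below (Children.left (children i)))
  right-leaf i = proj₁ (leaf-below (Children.right (children i)))

  separated-from-root : ∀ {i c ℓ} → Parent (inj₂ i) c → Descendant c (inj₁ ℓ) → Separated T i r₀ ℓ
  separated-from-root i-c c-ℓ r⇝ℓ =
    parent⇒≢root i-c (descendant-root (descendant-walk i-c c-ℓ (walk-reverse (adj-sym T) r⇝ℓ)))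

  root|left-leaf : ∀ i → Separated T i r₀ (left-leaf i)
  root|left-leaf i = separated-from-root (Children.left-parent (children i)) (proj₂ (leaf-below _))

  root|right-leaf : ∀ i → Separated T i r₀ (right-leaf i)
  root|right-leaf i = separated-from-root (Children.right-parent (children i)) (proj₂ (leaf-below _))

  left-leaf|right-leaf : ∀ i → Separated T i (left-leaf i) (right-leaf i)
  left-leaf|right-leaf i α⇝β =
    left≢right (ancestor-unique (descendant-walk left-parent (proj₂ (leaf-below left)) α⇝β)
                                (proj₂ (leaf-below right))
                                (trans (sym (proj₂ left-parent)) (proj₂ right-parent)))
    where open Children (children i)

  -- The star at r₀ (one pair per leaf) and one pair of leaves below the children of each interior vertex.
  rooted-pair : Fin m ⊎ Fin k → Fin m × Fin m
  rooted-pair = [ (r₀ ,_) , (λ i → left-leaf i , right-leaf i) ]′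

  rooted-ends : Fin (m + k) → Fin m × Fin m
  rooted-ends = rooted-pair ∘ splitAt m

  rooted-ends-join : ∀ e → rooted-ends (join m k e) ≡ rooted-pair e
  rooted-ends-join e = cong rooted-pair (splitAt-join m k e)

  rooted-cover : PairRel m
  rooted-cover = spanned rooted-ends

  rooted-cover-isCover : IsTripletCover T rooted-cover
  rooted-cover-isCover i =
    r₀ , α , β , (root|left-leaf i , root|right-leaf i , left-leaf|right-leaf i)
    , contains (inj₁ α) (separated⇒≢ T (root|left-leaf i))
    , contains (inj₁ β) (separated⇒≢ T (root|right-leaf i))
    , contains (inj₂ i) (separated⇒≢ T (left-leaf|right-leaf i))
    where
    α = left-leaf i
    β = right-leaf i
    contains : ∀ e → let (u , v) = rooted-pair e in u ≢ v → rooted-cover u v ≡ true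
    contains e = spanned-∋ rooted-ends (join m k e) (rooted-ends-join e)

  minimum-cover-degreeSum : (P : PairRel m) → IsMinimumTripletCover T P → degreeSum P ≤ (m + k) * 2
  minimum-cover-degreeSum P (P-pairs , _ , minimum) = begin
    degreeSum P                            ≡⟨ degreeSum-handshake P P-pairs ⟩
    size P + size P                        ≤⟨ +-mono-≤ smaller smaller ⟩
    size rooted-cover + size rooted-cover  ≡⟨ degreeSum-handshake rooted-cover Q-pairs ⟨
    degreeSum rooted-cover                 ≤⟨ degreeSum-spanned rooted-ends ⟩
    (m + k) * 2                            ∎
    where
    open ≤-Reasoning
    Q-pairs = spanned-isPairSet rooted-ends
    smaller = minimum rooted-cover Q-pairs rooted-cover-isCover

proposition2 : ∀ (m k : ℕ) → 3 ≤ m → (T : BinaryPhyloTree m k) →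
    (∀ (P : PairRel m) → IsMinimalTripletCover T P → MuBetween 2 5 P)
    × (∀ (P : PairRel m) → IsMinimumTripletCover T P → MuBetween 2 3 P)
proposition2 m@(suc _) k 3≤m T =
    (λ P P-minimal@(P-pairs , P-cover , _) →
       mult≥2 T 3≤m P P-pairs P-cover
       , ∑<⇒∃≤ (mult P) 5 (≤-<-trans (minimal-cover-degreeSum T P P-minimal) (*-monoˡ-< 6 k<m)))
  , (λ P P-minimum@(P-pairs , P-cover , _) →
       mult≥2 T 3≤m P P-pairs P-cover
       , ∑<⇒∃≤ (mult P) 3 (≤-<-trans (minimum-cover-degreeSum T zero P P-minimum) m+k<2m))
  where
  k<m : k < m
  k<m = interior<leaves T zero
  m+k<2m : (m + k) * 2 < m * 4
  m+k<2m = <-≤-trans (*-monoˡ-< 2 (+-monoʳ-< m k<m))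
                     (≤-reflexive (trans (*-distribʳ-+ 2 m m) (sym (*-distribˡ-+ m 2 2))))
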